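{- For an integer $n\ge 1$ let $P_n$ denote the path graph on $n$ vertices, and let $\chi_d^{\min}(P_n)$ be the minimum of $\chi_d(D)$ over all orientations $D$ of $P_n$. Then for every integer $k\geq 1$, \[ \chi_d^{\min}(P_n)=\begin{cases} k+2 & \text{if } n=4k,\\ k+2 & \text{if } n=4k+1,\\ k+3 & \text{if } n=4k+2,\\ k+3 & \text{if } n=4k+3, \end{cases} \] with the single exception $\chi_d^{\min}(P_6)=3$.
   Context: All digraphs are orientations of simple graphs (no loops, at most one arc between two vertices). For a digraph $D$ and $v\in V(D)$, $N^+(v)=\{u: vu\in A(D)\}$. A dominator coloring of $D$ is a partition of $V(D)$ into color classes such that (i) it is a proper coloring of the underlying graph (adjacent vertices receive different colors), and (ii) every vertex $v$ with at least one out-neighbor dominates some color class, i.e., there is a color class $C$ with $C\subseteq N^+(v)$; vertices of out-degree $0$ are not required to dominate anything. $\chi_d(D)$ is the minimum number of color classes in a dominator coloring of $D$. -}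

module Defs where

open import Data.Nat using (ℕ; zero; suc; pred; _<_; _≤_)
open import Data.Fin using (Fin; toℕ)
open import Data.Bool using (Bool; true; false)
open import Data.Product using (Σ; ∃; _×_; _,_)
open import Data.Sum using (_⊎_)
open import Relation.Binary.PropositionalEquality using (_≡_; _≢_)
open import Relation.Nullary using (¬_)

-- An orientation of the path P_n on vertex set Fin n (edges {i, i+1},
-- i = 0 .. n-2): for each edge index i : Fin (pred n),
-- true means the arc i → i+1, false means the arc i+1 → i.
PathOrientation : ℕ → Set
PathOrientation n = Fin (pred n) → Bool

Arc : {n : ℕ} → PathOrientation n → Fin n → Fin n → Set
Arc {n} D u v = Σ (Fin (pred n)) λ i →
    (toℕ u ≡ toℕ i × toℕ v ≡ suc (toℕ i) × D i ≡ true)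
  ⊎ (toℕ v ≡ toℕ i × toℕ u ≡ suc (toℕ i) × D i ≡ false)

DominatesClass : {n m : ℕ} → PathOrientation n → (Fin n → Fin m) → Fin n → Fin m → Set
DominatesClass {n} D c v j = (∃ λ u → c u ≡ j) × (∀ u → c u ≡ j → Arc {n} D v u)

IsDominatorColoring : {n m : ℕ} → PathOrientation n → (Fin n → Fin m) → Set
IsDominatorColoring {n} {m} D c =
    (∀ u v → Arc {n} D u v → c u ≢ c v)
  × (∀ v → (∃ λ u → Arc {n} D v u) → ∃ λ j → DominatesClass {n} D c v j)

HasDominatorColoring : {n : ℕ} → PathOrientation n → ℕ → Set
HasDominatorColoring {n} D m = Σ (Fin n → Fin m) λ c → IsDominatorColoring D c

ChiD : {n : ℕ} → PathOrientation n → ℕ → Set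
ChiD {n} D m = HasDominatorColoring {n} D m × (∀ m' → m' < m → ¬ HasDominatorColoring {n} D m')

ChiDMinPath : ℕ → ℕ → Set
ChiDMinPath n m =
    (∃ λ (D : PathOrientation n) → ChiD {n} D m)
  × (∀ (D : PathOrientation n) m' → ChiD {n} D m' → m ≤ m')

module Submission where

-- In a dominator colouring, every vertex x with an out-neighbour dominates a
-- class, and that class lies in N⁺(x) ⊆ {x − 1, x + 1}; fix one such class per x and call
-- these classes chosen.  Every vertex v is attached to a chosen class K(v): its own class if
-- that is chosen, otherwise the class chosen by v or by an in-neighbour of v (the left one
-- unless v = 0).  The least element of K(v) then lies in v − 2 .. v + 1 (or is 2 when v = 0),
-- so v ↦ (K(v), offset) is injective.  If two colours are not chosen, this injects the
-- vertices 1 .. n − 1 into pairs (chosen colour, offset) avoiding the 2 · 4 pairs of the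
-- unchosen colours: n + 7 ≤ 4m.  If only one colour is not chosen but some vertex is
-- outside the chosen classes, all such vertices share that colour, hence are pairwise
-- non-adjacent, and three slots per class suffice: n + 3 ≤ 3m.  Otherwise every vertex lies
-- in a chosen class, and two vertices of one class would both be out-neighbours of its
-- dominator x, with the vertex dominating x's own class among them: n ≤ m.
--
-- Orient the path alternately with the odd vertices as sources.  Colour the
-- odd vertices 0, the vertices 4q with 1, and give each vertex 4q + 2 a colour of its own:
-- every source is adjacent to some 4q + 2, whose class it then dominates.  This fails only
-- for the last vertex of P_{4k+2}, which is instead handled as the window 1 .. 4k + 2 of
-- P_{4k+3}.  P₆ has the special 3-colouring {0, 2}, {4}, {1, 3, 5}.

open import Defs
open import Data.Nat using (ℕ; zero; suc; pred; _+_; _*_; _≤_; _<_; z≤n; s≤s; _%_; _≟_)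
open import Data.Nat.Properties
  using (suc-injective; ≤-refl; ≤-pred; ≤-trans; ≤-antisym; n≤1+n; m≤n⇒m≤1+n; ≤∧≢⇒<; <-≤-trans; <⇒≱;
         1+n≰n; 0≢1+n; 1+n≢0; m≢1+n+m; suc[m]≤n⇒m≤pred[n]; m≤m+n;
         +-suc; +-identityʳ; +-cancelˡ-≡; +-monoʳ-<; *-cancelʳ-<)
open import Data.Nat.DivMod using ([m+kn]%n≡m%n; m<n⇒m%n≡m)
open import Data.Nat.Tactic.RingSolver using (solve-∀)
open import Data.Fin using (Fin; zero; suc; toℕ; fromℕ<; inject₁; #_)
open import Data.Fin.Properties
  using (toℕ-injective; toℕ-fromℕ<; toℕ-inject₁; toℕ<n; injective⇒≤; all?; any?; +↔⊎; *↔×)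
  renaming (_≟_ to _≟ᶠ_)
open import Data.Bool using (Bool; true; false; not)
open import Data.Bool.Properties using (not-¬; not-involutive) renaming (_≟_ to _≟ᵇ_)
open import Data.Vec using (lookup; _∷_; [])
open import Data.Product using (∃; _×_; _,_; proj₁; proj₂)
open import Data.Product.Properties using (,-injective)
open import Data.Sum using (_⊎_; inj₁; inj₂)
import Data.Sum as Sum
open import Data.Sum.Function.Propositional using (_⊎-↔_)
open import Data.Empty using (⊥-elim)
open import Function using (_∘_; Injective)
open import Function.Bundles using (mk↣; Injection)
open import Function.Construct.Composition using (_↣-∘_; _↔-∘_)
open import Function.Properties.Inverse using (↔-refl; ↔-sym; ↔⇒↣)
open import Relation.Binary.PropositionalEquality
  using (_≡_; _≢_; refl; sym; trans; cong; cong₂; subst; subst₂; module ≡-Reasoning)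
open import Relation.Nullary using (Dec; yes; no; ¬_)
open import Relation.Nullary.Decidable using (_×-dec_; _⊎-dec_; _→-dec_; ¬?; decidable-stable; toWitness)

disjoint-injections⇒≤ : ∀ {a b c e} (k : Fin a → Fin c) (s : Fin a → Fin e) (g : Fin b → Fin c) →
                        (∀ x y → k x ≡ k y → s x ≡ s y → x ≡ y) → Injective _≡_ _≡_ g →
                        (∀ x y → k x ≢ g y) → a + b * e ≤ c * e
disjoint-injections⇒≤ {a} {b} {c} {e} k s g ks-injective g-injective disjoint =
  injective⇒≤ (Injection.injective
    (↔⇒↣ (↔-sym *↔×) ↣-∘ (mk↣ f-injective ↣-∘ ↔⇒↣ ((↔-refl ⊎-↔ *↔×) ↔-∘ +↔⊎))))
  where
  f : Fin a ⊎ Fin b × Fin e → Fin c × Fin e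
  f (inj₁ x) = k x , s x
  f (inj₂ (y , z)) = g y , z

  f-injective : Injective _≡_ _≡_ f
  f-injective {inj₁ x} {inj₁ x′} eq =
    let kx≡ , sx≡ = ,-injective eq in cong inj₁ (ks-injective x x′ kx≡ sx≡)
  f-injective {inj₁ x} {inj₂ (y , _)} eq = ⊥-elim (disjoint x y (proj₁ (,-injective eq)))
  f-injective {inj₂ (y , _)} {inj₁ x} eq = ⊥-elim (disjoint x y (sym (proj₁ (,-injective eq))))
  f-injective {inj₂ (y , z)} {inj₂ (y′ , z′)} eq with ,-injective eq
  ... | gy≡gy′ , refl = cong (λ y → inj₂ (y , z)) (g-injective gy≡gy′)

least-witness : ∀ {n} {P : Fin n → Set} → (∀ u → Dec (P u)) → ∃ P →
                ∃ λ u → P u × (∀ w → P w → toℕ u ≤ toℕ w)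
least-witness {zero} _ (() , _)
least-witness {suc n} {P} P? (u , pu) with P? zero
... | yes p0 = zero , p0 , λ _ _ → z≤n
... | no ¬p0 with least-witness (P? ∘ suc) (predecessor u pu)
  where
  predecessor : ∀ u → P u → ∃ (P ∘ suc)
  predecessor zero p0 = ⊥-elim (¬p0 p0)
  predecessor (suc u) pu = u , pu
...   | u′ , pu′ , least =
  suc u′ , pu′ , λ { zero p0 → ⊥-elim (¬p0 p0) ; (suc w) pw → s≤s (least w pw) }

Adjacent : ℕ → ℕ → Set
Adjacent x u = u ≡ suc x ⊎ x ≡ suc u

adjacent⇒≤suc : ∀ {x u} → Adjacent x u → x ≤ suc u
adjacent⇒≤suc (inj₁ refl) = m≤n⇒m≤1+n (n≤1+n _)
adjacent⇒≤suc (inj₂ refl) = ≤-refl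

module Arcs {n : ℕ} (D : PathOrientation n) where

  infix 4 _⟶_
  _⟶_ : Fin n → Fin n → Set
  _⟶_ = Arc {n} D

  arc⇒adjacent : ∀ {x u} → x ⟶ u → Adjacent (toℕ x) (toℕ u)
  arc⇒adjacent (i , inj₁ (x≡i , u≡1+i , _)) = inj₁ (trans u≡1+i (cong suc (sym x≡i)))
  arc⇒adjacent (i , inj₂ (u≡i , x≡1+i , _)) = inj₂ (trans x≡1+i (cong suc (sym u≡i)))

  arc-asym : ∀ {x u} → x ⟶ u → ¬ u ⟶ x
  arc-asym (i , inj₁ (x≡i , _ , Di≡t)) (j , inj₂ (x≡j , _ , Dj≡f))
    with toℕ-injective (trans (sym x≡i) x≡j)
  ... | refl = not-¬ Di≡t Dj≡f
  arc-asym (i , inj₂ (u≡i , _ , Di≡f)) (j , inj₁ (u≡j , _ , Dj≡t))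
    with toℕ-injective (trans (sym u≡i) u≡j)
  ... | refl = not-¬ Di≡f Dj≡t
  arc-asym (i , inj₁ (x≡i , u≡1+i , _)) (j , inj₁ (u≡j , x≡1+j , _)) =
    m≢1+n+m _ (trans x≡1+j (cong suc (trans (sym u≡j) (trans u≡1+i (cong suc (sym x≡i))))))
  arc-asym (i , inj₂ (u≡i , x≡1+i , _)) (j , inj₂ (x≡j , u≡1+j , _)) =
    m≢1+n+m _ (trans x≡1+i (cong suc (trans (sym u≡i) (trans u≡1+j (cong suc (sym x≡j))))))

  edge⇒arc : ∀ {u v} (i : Fin (pred n)) → toℕ u ≡ toℕ i → toℕ v ≡ suc (toℕ i) → u ⟶ v ⊎ v ⟶ u
  edge⇒arc i u≡i v≡1+i with D i in Di
  ... | true = inj₁ (i , inj₁ (u≡i , v≡1+i , Di))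
  ... | false = inj₂ (i , inj₂ (u≡i , v≡1+i , Di))

  adjacent⇒arc : ∀ u v → toℕ v ≡ suc (toℕ u) → u ⟶ v ⊎ v ⟶ u
  adjacent⇒arc u v v≡1+u =
    edge⇒arc (fromℕ< u<n-1) (sym (toℕ-fromℕ< u<n-1)) (trans v≡1+u (cong suc (sym (toℕ-fromℕ< u<n-1))))
    where
    u<n-1 : toℕ u < pred n
    u<n-1 = suc[m]≤n⇒m≤pred[n] (subst (_< n) v≡1+u (toℕ<n v))

  arc? : ∀ x u → Dec (x ⟶ u)
  arc? x u = any? λ i → (toℕ x ≟ toℕ i ×-dec toℕ u ≟ suc (toℕ i) ×-dec D i ≟ᵇ true)
                     ⊎-dec (toℕ u ≟ toℕ i ×-dec toℕ x ≟ suc (toℕ i) ×-dec D i ≟ᵇ false)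

-- Lower bound

module DominatorColouringCount {n m : ℕ} (D : PathOrientation (suc (suc n)))
         (c : Fin (suc (suc n)) → Fin m) (dominator : IsDominatorColoring D c) where

  open Arcs {suc (suc n)} D

  private
    V : Set
    V = Fin (suc (suc n))

  HasOut : V → Set
  HasOut v = ∃ (v ⟶_)

  hasOut? : ∀ v → Dec (HasOut v)
  hasOut? v = any? (arc? v)

  -- For a vertex without out-neighbour, chosen v is the junk value c v.
  opaque
    chosen : V → Fin m
    chosen v with hasOut? v
    ... | yes out = proj₁ (proj₂ dominator v out)
    ... | no _ = c v

    chosen-dominated : ∀ {v} → HasOut v → DominatesClass D c v (chosen v)
    chosen-dominated {v} out with hasOut? v
    ... | yes out′ = proj₂ (proj₂ dominator v out′)
    ... | no ¬out = ⊥-elim (¬out out)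

  Chosen : Fin m → Set
  Chosen j = ∃ λ x → HasOut x × chosen x ≡ j

  chosen? : ∀ j → Dec (Chosen j)
  chosen? j = any? λ x → hasOut? x ×-dec chosen x ≟ᶠ j

  Covered : V → Set
  Covered v = Chosen (c v)

  data Anchored (v : V) : V → Set where
    in-class   : ∀ {x} → c v ≡ chosen x → x ⟶ v → Anchored v x
    self       : ¬ Covered v → HasOut v → Anchored v v
    from-left  : ∀ {x} → ¬ Covered v → x ⟶ v → toℕ v ≡ suc (toℕ x) → Anchored v x
    from-right : ∀ {x} → ¬ Covered v → x ⟶ v → toℕ v ≡ 0 → Anchored v x

  anchored-hasOut : ∀ {v x} → Anchored v x → HasOut x
  anchored-hasOut (in-class _ x⟶v) = _ , x⟶v
  anchored-hasOut (self _ out) = out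
  anchored-hasOut (from-left _ x⟶v _) = _ , x⟶v
  anchored-hasOut (from-right _ x⟶v _) = _ , x⟶v

  anchored-≤ : ∀ {v x} → Anchored v x → toℕ x ≤ suc (toℕ v)
  anchored-≤ (in-class _ x⟶v) = adjacent⇒≤suc (arc⇒adjacent x⟶v)
  anchored-≤ (self _ _) = n≤1+n _
  anchored-≤ (from-left _ x⟶v _) = adjacent⇒≤suc (arc⇒adjacent x⟶v)
  anchored-≤ (from-right _ x⟶v _) = adjacent⇒≤suc (arc⇒adjacent x⟶v)

  in-neighbour-anchor : ∀ v → ¬ Covered v → ¬ HasOut v → ∃ (Anchored v)
  in-neighbour-anchor zero ¬cov ¬out with adjacent⇒arc zero (suc zero) refl
  ... | inj₁ 0⟶1 = ⊥-elim (¬out (_ , 0⟶1))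
  ... | inj₂ 1⟶0 = suc zero , from-right ¬cov 1⟶0 refl
  in-neighbour-anchor (suc w) ¬cov ¬out
    with adjacent⇒arc (inject₁ w) (suc w) (cong suc (sym (toℕ-inject₁ w)))
  ... | inj₁ w⟶v = inject₁ w , from-left ¬cov w⟶v (cong suc (sym (toℕ-inject₁ w)))
  ... | inj₂ v⟶w = ⊥-elim (¬out (_ , v⟶w))

  opaque
    anchor : ∀ v → ∃ (Anchored v)
    anchor v with chosen? (c v)
    ... | yes (x , out , x∼v) = x , in-class (sym x∼v) (proj₂ (chosen-dominated out) v (sym x∼v))
    ... | no ¬cov with hasOut? v
    ...   | yes out = v , self ¬cov out
    ...   | no ¬out = in-neighbour-anchor v ¬cov ¬out

  anchor-of : V → V
  anchor-of v = proj₁ (anchor v)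

  class : V → Fin m
  class v = chosen (anchor-of v)

  class-dominated : ∀ v → DominatesClass D c (anchor-of v) (class v)
  class-dominated v = chosen-dominated (anchored-hasOut (proj₂ (anchor v)))

  class-chosen : ∀ v → Chosen (class v)
  class-chosen v = anchor-of v , anchored-hasOut (proj₂ (anchor v)) , refl

  opaque
    first-member : ∀ v → ∃ λ u → c u ≡ class v × (∀ w → c w ≡ class v → toℕ u ≤ toℕ w)
    first-member v = least-witness (λ u → c u ≟ᶠ class v) (proj₁ (class-dominated v))

  start : V → ℕ
  start v = toℕ (proj₁ (first-member v))

  start-determined : ∀ v w → class v ≡ class w → start v ≡ start w
  start-determined v w v∼w = ≤-antisym
    (proj₂ (proj₂ (first-member v)) _ (trans (proj₁ (proj₂ (first-member w))) (sym v∼w)))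
    (proj₂ (proj₂ (first-member w)) _ (trans (proj₁ (proj₂ (first-member v))) v∼w))

  -- The index is the slot of v when only one colour is not chosen.
  data Position (v : V) : Fin 3 → Set where
    covered+0   : c v ≡ class v → toℕ v ≡ start v → Position v zero
    covered+2   : c v ≡ class v → toℕ v ≡ 2 + start v → Position v (suc zero)
    uncovered-1 : ¬ Covered v → suc (toℕ v) ≡ start v → Position v (suc zero)
    uncovered-2 : ¬ Covered v → toℕ v ≡ 0 → start v ≡ 2 → Position v (suc zero)
    uncovered+1 : ¬ Covered v → toℕ v ≡ suc (start v) → Position v (suc (suc zero))
    uncovered+2 : ¬ Covered v → toℕ v ≡ 2 + start v → Position v (suc (suc zero))

  position : ∀ v → ∃ (Position v)
  position v = locate (proj₂ (anchor v)) (proj₂ (class-dominated v) μ μ∈) refl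
    where
    μ : V
    μ = proj₁ (first-member v)

    μ∈ : c μ ≡ class v
    μ∈ = proj₁ (proj₂ (first-member v))

    μ-least : ∀ w → c w ≡ class v → start v ≤ toℕ w
    μ-least = proj₂ (proj₂ (first-member v))

    μ≢v : ¬ Covered v → toℕ μ ≢ toℕ v
    μ≢v ¬cov μ≡v = ¬cov (subst Chosen (trans (sym μ∈) (cong c (toℕ-injective μ≡v))) (class-chosen v))

    locate : ∀ {x} → Anchored v x → x ⟶ μ → chosen x ≡ class v → ∃ (Position v)
    locate (in-class v∈x x⟶v) x⟶μ x∼v with arc⇒adjacent x⟶v | arc⇒adjacent x⟶μ
    ... | inj₁ v≡1+x | inj₁ μ≡1+x = _ , covered+0 (trans v∈x x∼v) (trans v≡1+x (sym μ≡1+x))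
    ... | inj₁ v≡1+x | inj₂ x≡1+μ = _ , covered+2 (trans v∈x x∼v) (trans v≡1+x (cong suc x≡1+μ))
    ... | inj₂ x≡1+v | inj₁ μ≡1+x =
      ⊥-elim (1+n≰n (≤-trans (n≤1+n _)
        (subst (_≤ toℕ v) (trans μ≡1+x (cong suc x≡1+v)) (μ-least v (trans v∈x x∼v)))))
    ... | inj₂ x≡1+v | inj₂ x≡1+μ = _ , covered+0 (trans v∈x x∼v) (suc-injective (trans (sym x≡1+v) x≡1+μ))
    locate (self ¬cov _) v⟶μ _ with arc⇒adjacent v⟶μ
    ... | inj₁ μ≡1+v = _ , uncovered-1 ¬cov (sym μ≡1+v)
    ... | inj₂ v≡1+μ = _ , uncovered+1 ¬cov v≡1+μ
    locate (from-left ¬cov _ v≡1+x) x⟶μ _ with arc⇒adjacent x⟶μ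
    ... | inj₁ μ≡1+x = ⊥-elim (μ≢v ¬cov (trans μ≡1+x (sym v≡1+x)))
    ... | inj₂ x≡1+μ = _ , uncovered+2 ¬cov (trans v≡1+x (cong suc x≡1+μ))
    locate (from-right ¬cov x⟶v v≡0) x⟶μ _ with arc⇒adjacent x⟶v | arc⇒adjacent x⟶μ
    ... | inj₁ v≡1+x | _ = ⊥-elim (0≢1+n (trans (sym v≡0) v≡1+x))
    ... | inj₂ x≡1+v | inj₁ μ≡1+x =
      _ , uncovered-2 ¬cov v≡0 (trans μ≡1+x (cong suc (trans x≡1+v (cong suc v≡0))))
    ... | inj₂ x≡1+v | inj₂ x≡1+μ = ⊥-elim (μ≢v ¬cov (suc-injective (trans (sym x≡1+μ) x≡1+v)))

  covered⇒in-class : ∀ v → Covered v → c v ≡ class v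
  covered⇒in-class v cov with anchor v
  ... | _ , in-class v∈ _ = v∈
  ... | _ , self ¬cov _ = ⊥-elim (¬cov cov)
  ... | _ , from-left ¬cov _ _ = ⊥-elim (¬cov cov)
  ... | _ , from-right ¬cov _ _ = ⊥-elim (¬cov cov)

  class-near : ∀ v w → c v ≡ class w → toℕ v ≤ 2 + toℕ w
  class-near v w v∈ = ≤-trans (adjacent⇒≤suc (Sum.swap (arc⇒adjacent (proj₂ (class-dominated w) v v∈))))
                              (s≤s (anchored-≤ (proj₂ (anchor w))))

  -- Distinct members u, w of a class are x − 1 and x + 1 for its dominator x; the anchor
  -- of x is then u or w, which is impossible since x ⟶ u and x ⟶ w.
  all-covered⇒injective : (∀ v → Covered v) → ∀ u w → c u ≡ c w → toℕ u ≡ toℕ w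
  all-covered⇒injective covered u w cu≡cw =
    compare (arc⇒adjacent x⟶u) (arc⇒adjacent x⟶w) (arc⇒adjacent y⟶x)
    where
    x y : V
    x = anchor-of u
    y = anchor-of x
    x⟶u : x ⟶ u
    x⟶u = proj₂ (class-dominated u) u (covered⇒in-class u (covered u))
    x⟶w : x ⟶ w
    x⟶w = proj₂ (class-dominated u) w (trans (sym cu≡cw) (covered⇒in-class u (covered u)))
    y⟶x : y ⟶ x
    y⟶x = proj₂ (class-dominated x) x (covered⇒in-class x (covered x))
    y≢out : ∀ {z} → x ⟶ z → toℕ y ≢ toℕ z
    y≢out x⟶z y≡z with toℕ-injective y≡z
    ... | refl = arc-asym y⟶x x⟶z
    compare : Adjacent (toℕ x) (toℕ u) → Adjacent (toℕ x) (toℕ w) → Adjacent (toℕ y) (toℕ x) →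
              toℕ u ≡ toℕ w
    compare (inj₁ u≡1+x) (inj₁ w≡1+x) _ = trans u≡1+x (sym w≡1+x)
    compare (inj₂ x≡1+u) (inj₂ x≡1+w) _ = suc-injective (trans (sym x≡1+u) x≡1+w)
    compare (inj₁ u≡1+x) (inj₂ x≡1+w) (inj₁ x≡1+y) =
      ⊥-elim (y≢out x⟶w (suc-injective (trans (sym x≡1+y) x≡1+w)))
    compare (inj₁ u≡1+x) (inj₂ x≡1+w) (inj₂ y≡1+x) = ⊥-elim (y≢out x⟶u (trans y≡1+x (sym u≡1+x)))
    compare (inj₂ x≡1+u) (inj₁ w≡1+x) (inj₁ x≡1+y) =
      ⊥-elim (y≢out x⟶u (suc-injective (trans (sym x≡1+y) x≡1+u)))
    compare (inj₂ x≡1+u) (inj₁ w≡1+x) (inj₂ y≡1+x) = ⊥-elim (y≢out x⟶w (trans y≡1+x (sym w≡1+x)))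

  all-covered-bound : (∀ v → Covered v) → suc (suc n) ≤ m
  all-covered-bound covered =
    injective⇒≤ λ {u} {w} cu≡cw → toℕ-injective (all-covered⇒injective covered u w cu≡cw)

  -- toℕ v + 1 ∸ start v, except at uncovered-2, which occurs only at vertex 0.
  offset : ∀ {v s} → Position v s → Fin 4
  offset (covered+0 _ _) = suc zero
  offset (covered+2 _ _) = suc (suc (suc zero))
  offset (uncovered-1 _ _) = zero
  offset (uncovered-2 _ _ _) = zero
  offset (uncovered+1 _ _) = suc (suc zero)
  offset (uncovered+2 _ _) = suc (suc (suc zero))

  offset-correct : ∀ {v s} (p : Position v s) → toℕ v ≢ 0 → suc (toℕ v) ≡ toℕ (offset p) + start v
  offset-correct (covered+0 _ v≡) _ = cong suc v≡
  offset-correct (covered+2 _ v≡) _ = cong suc v≡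
  offset-correct (uncovered-1 _ v≡) _ = v≡
  offset-correct (uncovered-2 _ v≡0 _) v≢0 = ⊥-elim (v≢0 v≡0)
  offset-correct (uncovered+1 _ v≡) _ = cong suc v≡
  offset-correct (uncovered+2 _ v≡) _ = cong suc v≡

  two-unchosen-bound : ∀ a b → a ≢ b → ¬ Chosen a → ¬ Chosen b → suc n + 2 * 4 ≤ m * 4
  two-unchosen-bound a b a≢b ¬a ¬b =
    disjoint-injections⇒≤ (class ∘ suc) (λ w → offset (proj₂ (position (suc w)))) unchosen
                          class-offset-injective unchosen-injective disjoint
    where
    unchosen : Fin 2 → Fin m
    unchosen zero = a
    unchosen (suc _) = b

    class-offset-injective : ∀ u w → class (suc u) ≡ class (suc w) →
                             offset (proj₂ (position (suc u))) ≡ offset (proj₂ (position (suc w))) → u ≡ w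
    class-offset-injective u w u∼w offset≡ = toℕ-injective (suc-injective (suc-injective (begin
      suc (suc (toℕ u))
        ≡⟨ offset-correct (proj₂ (position (suc u))) 1+n≢0 ⟩
      toℕ (offset (proj₂ (position (suc u)))) + start (suc u)
        ≡⟨ cong₂ _+_ (cong toℕ offset≡) (start-determined _ _ u∼w) ⟩
      toℕ (offset (proj₂ (position (suc w)))) + start (suc w)
        ≡⟨ offset-correct (proj₂ (position (suc w))) 1+n≢0 ⟨
      suc (suc (toℕ w))
        ∎)))
      where open ≡-Reasoning

    unchosen-injective : ∀ {i j} → unchosen i ≡ unchosen j → i ≡ j
    unchosen-injective {zero} {zero} _ = refl
    unchosen-injective {zero} {suc zero} a≡b = ⊥-elim (a≢b a≡b)
    unchosen-injective {suc zero} {zero} b≡a = ⊥-elim (a≢b (sym b≡a))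
    unchosen-injective {suc zero} {suc zero} _ = refl

    disjoint : ∀ w i → class (suc w) ≢ unchosen i
    disjoint w zero class≡a = ¬a (subst Chosen class≡a (class-chosen (suc w)))
    disjoint w (suc zero) class≡b = ¬b (subst Chosen class≡b (class-chosen (suc w)))

  start≤ : ∀ {v w} → c v ≡ class w → toℕ v ≡ 2 + start w → start w ≤ toℕ w
  start≤ {v} {w} v∈ v≡ = ≤-pred (≤-pred (subst (_≤ 2 + toℕ w) v≡ (class-near v w v∈)))

  module SharedUncoveredColour (a : Fin m) (¬chosen-a : ¬ Chosen a)
                               (uncovered-colour : ∀ v → ¬ Covered v → c v ≡ a) where

    uncovered-nonadjacent : ∀ {u v} → ¬ Covered u → ¬ Covered v → toℕ v ≢ suc (toℕ u)
    uncovered-nonadjacent {u} {v} ¬u ¬v v≡1+u with adjacent⇒arc u v v≡1+u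
    ... | inj₁ u⟶v = proj₁ dominator u v u⟶v (trans (uncovered-colour u ¬u) (sym (uncovered-colour v ¬v)))
    ... | inj₂ v⟶u = proj₁ dominator v u v⟶u (trans (uncovered-colour v ¬v) (sym (uncovered-colour u ¬u)))

    same-slot⇒same-vertex : ∀ {v w s} → Position v s → Position w s → class v ≡ class w → toℕ v ≡ toℕ w
    same-slot⇒same-vertex {v} {w} pv pw v∼w = compare pv pw
      where
      start≡ : start v ≡ start w
      start≡ = start-determined v w v∼w

      2≰0 : ¬ 2 ≤ 0
      2≰0 ()

      compare : ∀ {s} → Position v s → Position w s → toℕ v ≡ toℕ w
      compare (covered+0 _ v≡) (covered+0 _ w≡) = trans v≡ (trans start≡ (sym w≡))
      compare (covered+2 _ v≡) (covered+2 _ w≡) = trans v≡ (trans (cong (2 +_) start≡) (sym w≡))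
      compare (covered+2 v∈ v≡) (uncovered-1 _ w≡) =
        ⊥-elim (1+n≰n (subst (_≤ toℕ w) (sym w≡) (start≤ (trans v∈ v∼w) (trans v≡ (cong (2 +_) start≡)))))
      compare (covered+2 v∈ v≡) (uncovered-2 _ w≡0 start≡2) =
        ⊥-elim (2≰0 (subst₂ _≤_ start≡2 w≡0 (start≤ (trans v∈ v∼w) (trans v≡ (cong (2 +_) start≡)))))
      compare (uncovered-1 _ v≡) (covered+2 w∈ w≡) =
        ⊥-elim (1+n≰n (subst (_≤ toℕ v) (sym v≡)
          (start≤ (trans w∈ (sym v∼w)) (trans w≡ (cong (2 +_) (sym start≡))))))
      compare (uncovered-2 _ v≡0 start≡2) (covered+2 w∈ w≡) =
        ⊥-elim (2≰0 (subst₂ _≤_ start≡2 v≡0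
          (start≤ (trans w∈ (sym v∼w)) (trans w≡ (cong (2 +_) (sym start≡))))))
      compare (uncovered-1 _ v≡) (uncovered-1 _ w≡) = suc-injective (trans v≡ (trans start≡ (sym w≡)))
      compare (uncovered-1 ¬v v≡) (uncovered-2 ¬w w≡0 start≡2) =
        ⊥-elim (uncovered-nonadjacent ¬w ¬v
          (trans (suc-injective (trans v≡ (trans start≡ start≡2))) (cong suc (sym w≡0))))
      compare (uncovered-2 ¬v v≡0 start≡2) (uncovered-1 ¬w w≡) =
        ⊥-elim (uncovered-nonadjacent ¬v ¬w
          (trans (suc-injective (trans w≡ (trans (sym start≡) start≡2))) (cong suc (sym v≡0))))
      compare (uncovered-2 _ v≡0 _) (uncovered-2 _ w≡0 _) = trans v≡0 (sym w≡0)
      compare (uncovered+1 _ v≡) (uncovered+1 _ w≡) = trans v≡ (trans (cong suc start≡) (sym w≡))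
      compare (uncovered+1 ¬v v≡) (uncovered+2 ¬w w≡) =
        ⊥-elim (uncovered-nonadjacent ¬v ¬w (trans w≡ (cong suc (sym (trans v≡ (cong suc start≡))))))
      compare (uncovered+2 ¬v v≡) (uncovered+1 ¬w w≡) =
        ⊥-elim (uncovered-nonadjacent ¬w ¬v (trans v≡ (cong suc (sym (trans w≡ (cong suc (sym start≡)))))))
      compare (uncovered+2 _ v≡) (uncovered+2 _ w≡) = trans v≡ (trans (cong (2 +_) start≡) (sym w≡))

    shared-colour-bound : suc (suc n) + 1 * 3 ≤ m * 3
    shared-colour-bound =
      disjoint-injections⇒≤ {b = 1} class (proj₁ ∘ position) (λ _ → a) class-slot-injective
                            (λ { {zero} {zero} _ → refl })
                            (λ v _ class≡a → ¬chosen-a (subst Chosen class≡a (class-chosen v)))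
      where
      class-slot-injective : ∀ u w → class u ≡ class w → proj₁ (position u) ≡ proj₁ (position w) → u ≡ w
      class-slot-injective u w u∼w slot≡ with position u | position w | slot≡
      ... | _ , pu | _ , pw | refl = toℕ-injective (same-slot⇒same-vertex pu pw u∼w)

  colour-count-bound : suc (suc n) + 7 ≤ m * 4 ⊎ suc (suc n) + 3 ≤ m * 3 ⊎ suc (suc n) ≤ m
  colour-count-bound with any? (λ a → any? λ b → ¬? (a ≟ᶠ b) ×-dec ¬? (chosen? a) ×-dec ¬? (chosen? b))
  ... | yes (a , b , a≢b , ¬a , ¬b) =
    inj₁ (subst (_≤ m * 4) (cong suc (+-suc n 7)) (two-unchosen-bound a b a≢b ¬a ¬b))
  ... | no ¬two with any? (λ w → ¬? (chosen? (c w)))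
  ...   | yes (w , ¬w) = inj₂ (inj₁ (SharedUncoveredColour.shared-colour-bound (c w) ¬w same-colour))
    where
    same-colour : ∀ v → ¬ Covered v → c v ≡ c w
    same-colour v ¬v = decidable-stable (c v ≟ᶠ c w) λ cv≢cw → ¬two (c v , c w , cv≢cw , ¬v , ¬w)
  ...   | no ¬uncovered =
    inj₂ (inj₂ (all-covered-bound λ v → decidable-stable (chosen? (c v)) λ ¬v → ¬uncovered (v , ¬v)))

-- Upper bound

alternating : ∀ {n} → (ℕ → Bool) → PathOrientation n
alternating src i = src (toℕ i)

module Alternating {n : ℕ} (src : ℕ → Bool) (alternates : ∀ i → src (suc i) ≡ not (src i)) where

  D : PathOrientation n
  D = alternating {n} src

  open Arcs {n} D

  arc⇒source-sink : ∀ {u v} → u ⟶ v → src (toℕ u) ≡ true × src (toℕ v) ≡ false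
  arc⇒source-sink (i , inj₁ (u≡i , v≡1+i , src-i)) =
    trans (cong src u≡i) src-i , trans (cong src v≡1+i) (trans (alternates _) (cong not src-i))
  arc⇒source-sink (i , inj₂ (v≡i , u≡1+i , src-i)) =
    trans (cong src u≡1+i) (trans (alternates _) (cong not src-i)) , trans (cong src v≡i) src-i

  source-adjacent⇒arc : ∀ {v u} → src (toℕ v) ≡ true → Adjacent (toℕ v) (toℕ u) → v ⟶ u
  source-adjacent⇒arc {v} {u} src-v (inj₁ u≡1+v) with adjacent⇒arc v u u≡1+v
  ... | inj₁ v⟶u = v⟶u
  ... | inj₂ u⟶v = ⊥-elim (not-¬ src-v (proj₂ (arc⇒source-sink u⟶v)))
  source-adjacent⇒arc {v} {u} src-v (inj₂ v≡1+u) with adjacent⇒arc u v v≡1+u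
  ... | inj₁ u⟶v = ⊥-elim (not-¬ src-v (proj₂ (arc⇒source-sink u⟶v)))
  ... | inj₂ v⟶u = v⟶u

  alternating-dominator-colouring :
    ∀ {m} (c : Fin n → Fin m) →
    (∀ u v → src (toℕ u) ≡ true → src (toℕ v) ≡ false → c u ≢ c v) →
    (∀ v → src (toℕ v) ≡ true → ∃ λ t → ∀ u → c u ≡ c t → Adjacent (toℕ v) (toℕ u)) →
    HasDominatorColoring D m
  alternating-dominator-colouring c sources≢sinks singleton-target = c , proper , dominating
    where
    proper : ∀ u v → u ⟶ v → c u ≢ c v
    proper u v u⟶v = sources≢sinks u v (proj₁ (arc⇒source-sink u⟶v)) (proj₂ (arc⇒source-sink u⟶v))

    dominating : ∀ v → ∃ (v ⟶_) → ∃ (DominatesClass D c v)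
    dominating v (_ , v⟶u) with singleton-target v (proj₁ (arc⇒source-sink v⟶u))
    ... | t , class⊆N⁺ = c t , (t , refl) , λ u cu≡ct →
      source-adjacent⇒arc (proj₁ (arc⇒source-sink v⟶u)) (class⊆N⁺ u cu≡ct)

odd : ℕ → Bool
odd zero = false
odd (suc n) = not (odd n)

odd-4+ : ∀ u → odd (4 + u) ≡ odd u
odd-4+ u = trans (not-involutive _) (not-involutive _)

odd⇒adjacent-2+4q : ∀ v → odd v ≡ true → ∃ λ q → Adjacent v (2 + q * 4)
odd⇒adjacent-2+4q 0 ()
odd⇒adjacent-2+4q 1 _ = 0 , inj₁ refl
odd⇒adjacent-2+4q 2 ()
odd⇒adjacent-2+4q 3 _ = 0 , inj₂ refl
odd⇒adjacent-2+4q (suc (suc (suc (suc v)))) odd-v with odd⇒adjacent-2+4q v (trans (sym (odd-4+ v)) odd-v)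
... | q , adj = suc q , Sum.map (cong (4 +_)) (cong (4 +_)) adj

raise : ℕ → ℕ
raise 0 = 0
raise 1 = 1
raise (suc (suc k)) = suc (suc (suc k))

-- Odd vertices get 0, vertices 4q get 1, and vertex 4q + 2 gets its own colour q + 2.
colour : ℕ → ℕ
colour 0 = 1
colour 1 = 0
colour 2 = 2
colour 3 = 0
colour (suc (suc (suc (suc u)))) = raise (colour u)

colour-odd : ∀ u → odd u ≡ true → colour u ≡ 0
colour-odd 0 ()
colour-odd 1 _ = refl
colour-odd 2 ()
colour-odd 3 _ = refl
colour-odd (suc (suc (suc (suc u)))) odd-u rewrite colour-odd u (trans (sym (odd-4+ u)) odd-u) = refl

colour-even : ∀ u → odd u ≡ false → colour u ≢ 0
colour-even 0 _ ()
colour-even 1 ()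
colour-even 2 _ ()
colour-even 3 ()
colour-even (suc (suc (suc (suc u)))) even-u with colour u | colour-even u (trans (sym (odd-4+ u)) even-u)
... | 0 | colour≢0 = colour≢0
... | 1 | _ = λ ()
... | suc (suc _) | _ = λ ()

colour-2+4q : ∀ q → colour (2 + q * 4) ≡ 2 + q
colour-2+4q zero = refl
colour-2+4q (suc q) rewrite colour-2+4q q = refl

raise≢2 : ∀ k → raise k ≢ 2
raise≢2 0 ()
raise≢2 1 ()
raise≢2 (suc (suc k)) ()

raise≡3+⇒≡2+ : ∀ q k → raise k ≡ 3 + q → k ≡ 2 + q
raise≡3+⇒≡2+ q 0 ()
raise≡3+⇒≡2+ q 1 ()
raise≡3+⇒≡2+ q (suc (suc k)) raise≡ = suc-injective raise≡

colour≡2+q⇒≡2+4q : ∀ q u → colour u ≡ 2 + q → u ≡ 2 + q * 4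
colour≡2+q⇒≡2+4q q 0 ()
colour≡2+q⇒≡2+4q q 1 ()
colour≡2+q⇒≡2+4q zero 2 _ = refl
colour≡2+q⇒≡2+4q (suc q) 2 ()
colour≡2+q⇒≡2+4q q 3 ()
colour≡2+q⇒≡2+4q zero (suc (suc (suc (suc u)))) colour≡ = ⊥-elim (raise≢2 (colour u) colour≡)
colour≡2+q⇒≡2+4q (suc q) (suc (suc (suc (suc u)))) colour≡ =
  cong (4 +_) (colour≡2+q⇒≡2+4q q u (raise≡3+⇒≡2+ q (colour u) colour≡))

colour-2+4q-singleton : ∀ q u → colour u ≡ colour (2 + q * 4) → u ≡ 2 + q * 4
colour-2+4q-singleton q u colour≡ = colour≡2+q⇒≡2+4q q u (trans colour≡ (colour-2+4q q))

raise-< : ∀ q k → k < 2 + q → raise k < 3 + q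
raise-< q 0 _ = s≤s z≤n
raise-< q 1 _ = s≤s (s≤s z≤n)
raise-< q (suc (suc k)) k< = s≤s k<

colour-< : ∀ q u → u < 2 + q * 4 → colour u < 2 + q
colour-< q 0 _ = s≤s (s≤s z≤n)
colour-< q 1 _ = s≤s z≤n
colour-< zero (suc (suc u)) (s≤s (s≤s ()))
colour-< (suc q) 2 _ = s≤s (s≤s (s≤s z≤n))
colour-< (suc q) 3 _ = s≤s z≤n
colour-< (suc q) (suc (suc (suc (suc u)))) (s≤s (s≤s (s≤s (s≤s u<)))) = raise-< q (colour u) (colour-< q u u<)

module Window (s : ℕ) (s≢3+4r : ∀ r → s ≢ 3 + r * 4) where

  unshift : ∀ v {p} → Adjacent (s + v) p → s ≢ suc p → ∃ λ t → Adjacent v t × s + t ≡ p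
  unshift v (inj₁ p≡1+s+v) _ = suc v , inj₁ refl , trans (+-suc s v) (sym p≡1+s+v)
  unshift zero (inj₂ s+0≡1+p) s≢1+p = ⊥-elim (s≢1+p (trans (sym (+-identityʳ s)) s+0≡1+p))
  unshift (suc v) (inj₂ s+1+v≡1+p) _ = v , inj₂ refl , suc-injective (trans (sym (+-suc s v)) s+1+v≡1+p)

  adjacent-inside : ∀ {n v t} → v < n → Adjacent v t → s + t ≢ s + n → t < n
  adjacent-inside v<n (inj₁ refl) s+t≢s+n = ≤∧≢⇒< v<n (s+t≢s+n ∘ cong (s +_))
  adjacent-inside v<n (inj₂ refl) _ = ≤-trans (n≤1+n _) v<n

  neighbour-2+4r : ∀ n → (∀ r → s + n ≢ 2 + r * 4) → ∀ v → v < n → odd (s + v) ≡ true →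
                      ∃ λ t → t < n × Adjacent v t × ∃ λ r → s + t ≡ 2 + r * 4
  neighbour-2+4r n s+n≢2+4r v v<n odd-s+v with odd⇒adjacent-2+4q (s + v) odd-s+v
  ... | r , adj with unshift v adj (s≢3+4r r)
  ...   | t , v∼t , s+t≡ =
    t , adjacent-inside v<n v∼t (λ s+t≡s+n → s+n≢2+4r r (trans (sym s+t≡s+n) s+t≡)) , v∼t , r , s+t≡

  window-colouring : ∀ n q → s + n ≤ 2 + q * 4 → (∀ r → s + n ≢ 2 + r * 4) →
                     HasDominatorColoring {n} (alternating {n} (odd ∘ (s +_))) (2 + q)
  window-colouring n q s+n≤ s+n≢2+4r = alternating-dominator-colouring c sources≢sinks singleton-target
    where
    open Alternating {n} (odd ∘ (s +_)) (λ i → cong odd (+-suc s i))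

    bound : ∀ (u : Fin n) → colour (s + toℕ u) < 2 + q
    bound u = colour-< q (s + toℕ u) (≤-trans (+-monoʳ-< s (toℕ<n u)) s+n≤)

    c : Fin n → Fin (2 + q)
    c u = fromℕ< (bound u)

    c-colour : ∀ u v → c u ≡ c v → colour (s + toℕ u) ≡ colour (s + toℕ v)
    c-colour u v cu≡cv = trans (sym (toℕ-fromℕ< (bound u))) (trans (cong toℕ cu≡cv) (toℕ-fromℕ< (bound v)))

    sources≢sinks : ∀ u v → odd (s + toℕ u) ≡ true → odd (s + toℕ v) ≡ false → c u ≢ c v
    sources≢sinks u v odd-u even-v cu≡cv =
      colour-even (s + toℕ v) even-v (trans (sym (c-colour u v cu≡cv)) (colour-odd (s + toℕ u) odd-u))

    singleton-target : ∀ v → odd (s + toℕ v) ≡ true → ∃ λ t → ∀ u → c u ≡ c t → Adjacent (toℕ v) (toℕ u)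
    singleton-target v odd-v with neighbour-2+4r n s+n≢2+4r (toℕ v) (toℕ<n v) odd-v
    ... | t , t<n , v∼t , r , s+t≡ = fromℕ< t<n , λ u cu≡ct → subst (Adjacent (toℕ v)) (sym (u≡t u cu≡ct)) v∼t
      where
      u≡t : ∀ u → c u ≡ c (fromℕ< t<n) → toℕ u ≡ t
      u≡t u cu≡ct = +-cancelˡ-≡ s _ _ (trans (colour-2+4q-singleton r (s + toℕ u) colour≡) (sym s+t≡))
        where
        colour≡ : colour (s + toℕ u) ≡ colour (2 + r * 4)
        colour≡ = trans (c-colour u _ cu≡ct) (cong colour (trans (cong (s +_) (toℕ-fromℕ< t<n)) s+t≡))

-- The four families and P₆

more-colours-than : ∀ {n} b → 2 ≤ n → b * 4 < n + 7 → b * 3 < n + 3 → b < n →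
                    ∀ (D : PathOrientation n) m → HasDominatorColoring {n} D m → b < m
more-colours-than {zero} _ () _ _ _ _ _ _
more-colours-than {suc zero} _ (s≤s ()) _ _ _ _ _ _
more-colours-than {suc (suc n)} b _ b4< b3< b< D m (c , dominator)
  with DominatorColouringCount.colour-count-bound {n} D c dominator
... | inj₁ ≤m4 = *-cancelʳ-< 4 b m (<-≤-trans b4< ≤m4)
... | inj₂ (inj₁ ≤m3) = *-cancelʳ-< 3 b m (<-≤-trans b3< ≤m3)
... | inj₂ (inj₂ ≤m) = <-≤-trans b< ≤m

χd-min-path : ∀ {n} b (D : PathOrientation n) → HasDominatorColoring {n} D (suc b) →
              2 ≤ n → b * 4 < n + 7 → b * 3 < n + 3 → b < n → ChiDMinPath n (suc b)
χd-min-path {n} b D colouring 2≤n b4< b3< b< =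
  (D , colouring , λ m′ m′<1+b has → <⇒≱ m′<1+b (lower _ m′ has)) , λ D′ m′ χ → lower D′ m′ (proj₁ χ)
  where
  lower : ∀ (D′ : PathOrientation n) m → HasDominatorColoring {n} D′ m → b < m
  lower = more-colours-than {n} b 2≤n b4< b3< b<

0<4 : 0 < 4
0<4 = s≤s z≤n

1<4 : 1 < 4
1<4 = s≤s (s≤s z≤n)

3<4 : 3 < 4
3<4 = s≤s (s≤s (s≤s (s≤s z≤n)))

<-by : ∀ d {a b} → b ≡ suc (a + d) → a < b
<-by d {a} refl = s≤s (m≤m+n a d)

≤-by : ∀ d {a b} → b ≡ a + d → a ≤ b
≤-by d {a} refl = m≤m+n a d

not-2-mod-4 : ∀ {x} i q → x ≡ i + q * 4 → i < 4 → i ≢ 2 → ∀ r → x ≢ 2 + r * 4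
not-2-mod-4 {x} i q x≡ i<4 i≢2 r x≡′ = i≢2 (begin
  i                 ≡⟨ sym (m<n⇒m%n≡m i<4) ⟩
  i % 4             ≡⟨ sym ([m+kn]%n≡m%n i q 4) ⟩
  (i + q * 4) % 4   ≡⟨ cong (_% 4) (trans (sym x≡) x≡′) ⟩
  (2 + r * 4) % 4   ≡⟨ [m+kn]%n≡m%n 2 r 4 ⟩
  2                 ∎)
  where open ≡-Reasoning

χd-min-window : ∀ s n b q → (∀ r → s ≢ 3 + r * 4) → (∀ r → s + n ≢ 2 + r * 4) →
                s + n ≤ 2 + q * 4 → 2 + q ≡ suc b →
                2 ≤ n → b * 4 < n + 7 → b * 3 < n + 3 → b < n → ChiDMinPath n (suc b)
χd-min-window s n b q s≢3+4r s+n≢2+4r fits colours =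
  χd-min-path b D
    (subst (HasDominatorColoring {n} D) colours (Window.window-colouring s s≢3+4r n q fits s+n≢2+4r))
  where
  D : PathOrientation n
  D = alternating {n} (odd ∘ (s +_))

χd-min-4k : ∀ k → 1 ≤ k → ChiDMinPath (4 * k) (k + 2)
χd-min-4k (suc j) _ =
  χd-min-window 0 (4 * suc j) (j + 2) (suc j) (λ _ ()) (not-2-mod-4 0 (suc j) (n≡ j) 0<4 (λ ()))
    (≤-by 2 (fits j)) (colours j) (≤-by (2 + 4 * j) (n≥2 j))
    (<-by 2 (slack₄ j)) (<-by j (slack₃ j)) (<-by (3 * j + 1) (slack₁ j))
  where
  n≡ : ∀ j → 4 * suc j ≡ 0 + suc j * 4
  n≡ = solve-∀
  fits : ∀ j → 2 + suc j * 4 ≡ 4 * suc j + 2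
  fits = solve-∀
  colours : ∀ j → 2 + suc j ≡ suc (j + 2)
  colours = solve-∀
  n≥2 : ∀ j → 4 * suc j ≡ 2 + (2 + 4 * j)
  n≥2 = solve-∀
  slack₄ : ∀ j → 4 * suc j + 7 ≡ suc ((j + 2) * 4 + 2)
  slack₄ = solve-∀
  slack₃ : ∀ j → 4 * suc j + 3 ≡ suc ((j + 2) * 3 + j)
  slack₃ = solve-∀
  slack₁ : ∀ j → 4 * suc j ≡ suc (j + 2 + (3 * j + 1))
  slack₁ = solve-∀

χd-min-4k+1 : ∀ k → 1 ≤ k → ChiDMinPath (4 * k + 1) (k + 2)
χd-min-4k+1 (suc j) _ =
  χd-min-window 0 (4 * suc j + 1) (j + 2) (suc j) (λ _ ()) (not-2-mod-4 1 (suc j) (n≡ j) 1<4 (λ ()))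
    (≤-by 1 (fits j)) (colours j) (≤-by (3 + 4 * j) (n≥2 j))
    (<-by 3 (slack₄ j)) (<-by (j + 1) (slack₃ j)) (<-by (3 * j + 2) (slack₁ j))
  where
  n≡ : ∀ j → 4 * suc j + 1 ≡ 1 + suc j * 4
  n≡ = solve-∀
  fits : ∀ j → 2 + suc j * 4 ≡ 4 * suc j + 1 + 1
  fits = solve-∀
  colours : ∀ j → 2 + suc j ≡ suc (j + 2)
  colours = solve-∀
  n≥2 : ∀ j → 4 * suc j + 1 ≡ 2 + (3 + 4 * j)
  n≥2 = solve-∀
  slack₄ : ∀ j → 4 * suc j + 1 + 7 ≡ suc ((j + 2) * 4 + 3)
  slack₄ = solve-∀
  slack₃ : ∀ j → 4 * suc j + 1 + 3 ≡ suc ((j + 2) * 3 + (j + 1))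
  slack₃ = solve-∀
  slack₁ : ∀ j → 4 * suc j + 1 ≡ suc (j + 2 + (3 * j + 2))
  slack₁ = solve-∀

χd-min-4k+2 : ∀ k → 2 ≤ k → ChiDMinPath (4 * k + 2) (k + 3)
χd-min-4k+2 (suc zero) (s≤s ())
χd-min-4k+2 (suc (suc j)) _ =
  χd-min-window 1 (4 * k + 2) (suc (j + 3)) (suc k) (λ _ ()) (not-2-mod-4 3 k (n≡ j) 3<4 (λ ()))
    (≤-by 3 (fits j)) (colours j) (≤-by (8 + 4 * j) (n≥2 j))
    (<-by 0 (slack₄ j)) (<-by j (slack₃ j)) (<-by (3 * j + 5) (slack₁ j))
  where
  k : ℕ
  k = suc (suc j)
  n≡ : ∀ j → 1 + (4 * suc (suc j) + 2) ≡ 3 + suc (suc j) * 4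
  n≡ = solve-∀
  fits : ∀ j → 2 + suc (suc (suc j)) * 4 ≡ 1 + (4 * suc (suc j) + 2) + 3
  fits = solve-∀
  colours : ∀ j → 2 + suc (suc (suc j)) ≡ suc (suc (j + 3))
  colours = solve-∀
  n≥2 : ∀ j → 4 * suc (suc j) + 2 ≡ 2 + (8 + 4 * j)
  n≥2 = solve-∀
  slack₄ : ∀ j → 4 * suc (suc j) + 2 + 7 ≡ suc (suc (j + 3) * 4 + 0)
  slack₄ = solve-∀
  slack₃ : ∀ j → 4 * suc (suc j) + 2 + 3 ≡ suc (suc (j + 3) * 3 + j)
  slack₃ = solve-∀
  slack₁ : ∀ j → 4 * suc (suc j) + 2 ≡ suc (suc (j + 3) + (3 * j + 5))
  slack₁ = solve-∀

χd-min-4k+3 : ∀ k → 1 ≤ k → ChiDMinPath (4 * k + 3) (k + 3)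
χd-min-4k+3 (suc j) _ =
  χd-min-window 0 (4 * suc j + 3) (j + 3) (suc (suc j)) (λ _ ()) (not-2-mod-4 3 (suc j) (n≡ j) 3<4 (λ ()))
    (≤-by 3 (fits j)) (colours j) (≤-by (5 + 4 * j) (n≥2 j))
    (<-by 1 (slack₄ j)) (<-by j (slack₃ j)) (<-by (3 * j + 3) (slack₁ j))
  where
  n≡ : ∀ j → 4 * suc j + 3 ≡ 3 + suc j * 4
  n≡ = solve-∀
  fits : ∀ j → 2 + suc (suc j) * 4 ≡ 4 * suc j + 3 + 3
  fits = solve-∀
  colours : ∀ j → 2 + suc (suc j) ≡ suc (j + 3)
  colours = solve-∀
  n≥2 : ∀ j → 4 * suc j + 3 ≡ 2 + (5 + 4 * j)
  n≥2 = solve-∀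
  slack₄ : ∀ j → 4 * suc j + 3 + 7 ≡ suc ((j + 3) * 4 + 1)
  slack₄ = solve-∀
  slack₃ : ∀ j → 4 * suc j + 3 + 3 ≡ suc ((j + 3) * 3 + j)
  slack₃ = solve-∀
  slack₁ : ∀ j → 4 * suc j + 3 ≡ suc (j + 3 + (3 * j + 3))
  slack₁ = solve-∀

P₆-colouring : HasDominatorColoring {6} (alternating {6} odd) 3
P₆-colouring =
  alternating-dominator-colouring c₆ (toWitness {a? = proper?} _) (toWitness {a? = dominating?} _)
  where
  open Alternating {6} odd (λ _ → refl)

  c₆ : Fin 6 → Fin 3
  c₆ = lookup (# 1 ∷ # 0 ∷ # 1 ∷ # 0 ∷ # 2 ∷ # 0 ∷ [])

  proper? : Dec (∀ u v → odd (toℕ u) ≡ true → odd (toℕ v) ≡ false → c₆ u ≢ c₆ v)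
  proper? = all? λ u → all? λ v → odd (toℕ u) ≟ᵇ true →-dec odd (toℕ v) ≟ᵇ false →-dec ¬? (c₆ u ≟ᶠ c₆ v)

  dominating? : Dec (∀ v → odd (toℕ v) ≡ true → ∃ λ t → ∀ u → c₆ u ≡ c₆ t → Adjacent (toℕ v) (toℕ u))
  dominating? = all? λ v → odd (toℕ v) ≟ᵇ true →-dec any? λ t → all? λ u →
                  c₆ u ≟ᶠ c₆ t →-dec (toℕ u ≟ suc (toℕ v) ⊎-dec toℕ v ≟ suc (toℕ u))

χd-min-P₆ : ChiDMinPath 6 3
χd-min-P₆ =
  χd-min-path 2 (alternating {6} odd) P₆-colouring (s≤s (s≤s z≤n)) (<-by 4 refl) (<-by 2 refl) (<-by 3 refl)

theorem1 :
      (∀ (k : ℕ) → 1 ≤ k → ChiDMinPath (4 * k) (k + 2))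
    × (∀ (k : ℕ) → 1 ≤ k → ChiDMinPath (4 * k + 1) (k + 2))
    × (∀ (k : ℕ) → 2 ≤ k → ChiDMinPath (4 * k + 2) (k + 3))
    × (∀ (k : ℕ) → 1 ≤ k → ChiDMinPath (4 * k + 3) (k + 3))
    × ChiDMinPath 6 3
theorem1 = χd-min-4k , χd-min-4k+1 , χd-min-4k+2 , χd-min-4k+3 , χd-min-P₆
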